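{- Let $T$ be a finite rooted tree in which every inner node has at least two children, let $L$ be its set of leaves and $V$ its set of nodes; for a node $y$ let $T_y$ denote the subtree of descendants of $y$. Let $S\subseteq V\setminus L$, let $(\pi,\sigma)$ be a pair of injective maps from $S$ to $L$ identifying $S$ with unique request, and let $A=\pi(S)$, $B=\sigma(S)$. Then for each inner node $x$ of $T$, exactly one of the following three cases holds: (1) $x\notin S$, $x$ is not requested in $(\pi,\sigma)$, and for each child $c$ of $x$, $|A\cap V(T_c)|=|B\cap V(T_c)|$; (2) $x\notin S$, $x$ is requested in $(\pi,\sigma)$, and there exists a leaf $z\in(A\cup B)\cap V(T_x)$ such that for each child $c$ of $x$, $|(A\setminus\{z\})\cap V(T_c)|=|(B\setminus\{z\})\cap V(T_c)|$; (3) $x\in S$, $x$ is requested in $(\pi,\sigma)$, and there exist leaves $a\in A\cap V(T_x)$ and $b\in B\cap V(T_x)$ such that for each child $c$ of $x$, $|(A\setminus\{a\})\cap V(T_c)|=|(B\setminus\{b\})\cap V(T_c)|$ and $\{a,b\}\not\subseteq V(T_c)$. In particular, $x\in S$ if and only if there exist $a\in A\cap V(T_x)$ and $b\in B\cap V(T_x)$ such that for each child $c$ of $x$, $|(A\setminus\{a\})\cap V(T_c)|=|(B\setminus\{b\})\cap V(T_c)|$ and $\{a,b\}\not\subseteq V(T_c)$.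
   Context: Every node is an ancestor of itself. A pair $(\pi,\sigma)$ of injective maps from $S$ to $L$ identifies $S$ if for each $s\in S$, $s$ is the least common ancestor of $\pi(s)$ and $\sigma(s)$. For $s\in S$ and a node $x$, $x$ is $s$-requested in $(\pi,\sigma)$ if $x$ lies on the path from $\pi(s)$ to $\sigma(s)$; $x$ is requested if it is $s$-requested for some $s\in S$. The pair has unique request if every node is $s$-requested for at most one $s\in S$. -}

module Defs where

open import Data.Nat using (ℕ; zero; suc)
open import Data.Fin using (Fin; toℕ; _≟_)
open import Data.Fin.Properties using (any?)
open import Data.Fin.Subset using (Subset; _∈_)
open import Data.Fin.Subset.Properties using (_∈?_)
open import Data.Maybe using (Maybe; just; nothing)
import Data.Maybe.Properties as MP
open import Data.List using (length; filter)
open import Data.List.Base using ()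
open import Data.Fin.Base using ()
import Data.List as L
open import Data.Product using (Σ; ∃; ∃-syntax; _×_; _,_)
open import Data.Product.Properties using ()
open import Data.Sum using (_⊎_)
open import Relation.Nullary using (¬_; Dec; yes; no)
open import Relation.Nullary.Decidable using (_×-dec_; ¬?)
open import Relation.Unary using (Pred; Decidable)
open import Relation.Binary.PropositionalEquality using (_≡_; _≢_)
open import Level using (0ℓ)

-- Finite rooted trees in parent-array representation: nodes are Fin n,
-- parent x = nothing exactly for the root.
record RTree (n : ℕ) : Set where
  field
    parent : Fin n → Maybe (Fin n)
    root   : Fin n

module _ {n : ℕ} (t : RTree n) where
  open RTree t

  iter : ℕ → Fin n → Maybe (Fin n)
  iter zero    y = just y
  iter (suc k) y with iter k y
  ... | nothing = nothing
  ... | just z  = parent z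

  -- x is an ancestor of y (every node is an ancestor of itself).
  -- In a tree on n nodes every ancestor is reached in at most n steps.
  Anc : Fin n → Fin n → Set
  Anc x y = ∃[ k ] (iter (toℕ {suc n} k) y ≡ just x)

  Anc? : (x y : Fin n) → Dec (Anc x y)
  Anc? x y = any? (λ k → MP.≡-dec _≟_ (iter (toℕ {suc n} k) y) (just x))

  Child : Fin n → Fin n → Set
  Child c x = parent c ≡ just x

  Leaf : Fin n → Set
  Leaf x = ∀ c → ¬ Child c x

  Inner : Fin n → Set
  Inner x = ∃[ c ] Child c x

  record IsGoodTree : Set where
    field
      root-noParent : parent root ≡ nothing
      noParent⇒root : ∀ x → parent x ≡ nothing → x ≡ root
      root-anc      : ∀ x → Anc root x
      twoChildren   : ∀ x c → Child c x → ∃[ c' ] (Child c' x × c' ≢ c)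

  IsLCA : Fin n → Fin n → Fin n → Set
  IsLCA w u v = Anc w u × Anc w v × (∀ w' → Anc w' u → Anc w' v → Anc w' w)

  OnPath : Fin n → Fin n → Fin n → Set
  OnPath x u v = ∃[ w ] (IsLCA w u v × Anc w x × (Anc x u ⊎ Anc x v))

  module _ (S : Subset n) (π σ : Fin n → Fin n) where

    InjectiveLeafMapOn : (Fin n → Fin n) → Set
    InjectiveLeafMapOn f =
      (∀ s → s ∈ S → Leaf (f s)) ×
      (∀ s s' → s ∈ S → s' ∈ S → f s ≡ f s' → s ≡ s')

    Identifies : Set
    Identifies = ∀ s → s ∈ S → IsLCA s (π s) (σ s)

    SRequested : Fin n → Fin n → Set
    SRequested s x = OnPath x (π s) (σ s)

    Requested : Fin n → Set
    Requested x = ∃[ s ] (s ∈ S × SRequested s x)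

    UniqueRequest : Set
    UniqueRequest = ∀ x s s' → s ∈ S → s' ∈ S →
      SRequested s x → SRequested s' x → s ≡ s'

  InImg : Subset n → (Fin n → Fin n) → Fin n → Set
  InImg S f v = ∃[ s ] (s ∈ S × f s ≡ v)

  InImg? : (S : Subset n) (f : Fin n → Fin n) → Decidable (InImg S f)
  InImg? S f v = any? (λ s → (s ∈? S) ×-dec (f s ≟ v))

  count : (P : Pred (Fin n) 0ℓ) → Decidable P → ℕ
  count P P? = length (filter P? (L.allFin n))

  cntImg : Subset n → (Fin n → Fin n) → Fin n → ℕ
  cntImg S f c = count (λ v → InImg S f v × Anc c v)
                       (λ v → InImg? S f v ×-dec Anc? c v)

  cntImgMinus : Subset n → (Fin n → Fin n) → Fin n → Fin n → ℕ
  cntImgMinus S f z c =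
    count (λ v → (InImg S f v × v ≢ z) × Anc c v)
          (λ v → (InImg? S f v ×-dec ¬? (v ≟ z)) ×-dec Anc? c v)

  module _ (S : Subset n) (π σ : Fin n → Fin n) (x : Fin n) where

    Case1 : Set
    Case1 = ¬ (x ∈ S) × ¬ Requested S π σ x ×
      (∀ c → Child c x → cntImg S π c ≡ cntImg S σ c)

    Case2 : Set
    Case2 = ¬ (x ∈ S) × Requested S π σ x ×
      ∃[ z ] ((InImg S π z ⊎ InImg S σ z) × Anc x z ×
        (∀ c → Child c x → cntImgMinus S π z c ≡ cntImgMinus S σ z c))

    SplitCond : Set
    SplitCond = ∃[ a ] ∃[ b ] (InImg S π a × Anc x a × InImg S σ b × Anc x b ×
      (∀ c → Child c x →
         cntImgMinus S π a c ≡ cntImgMinus S σ b c × ¬ (Anc c a × Anc c b)))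

    Case3 : Set
    Case3 = x ∈ S × Requested S π σ x × SplitCond

    ExactlyOne : Set
    ExactlyOne = (Case1 ⊎ Case2 ⊎ Case3) ×
      ¬ (Case1 × Case2) × ¬ (Case1 × Case3) × ¬ (Case2 × Case3)

{-# OPTIONS --safe #-}
module Submission where

-- Fix an inner node x. If s ∈ S does not request x, then π s and σ s lie below the same child
-- of x or both outside T_x, so for every child c the map π s ↦ σ s injects A ∩ T_c into B ∩ T_c,
-- and symmetrically. By unique request at most one s requests x, and its leaves are the only
-- obstruction: if x ∈ S it is x itself, with π x and σ x below distinct children, and removing
-- π x from A and σ x from B restores the balance; if x ∉ S it is a proper ancestor r of x with
-- exactly one leaf z below x, and removing z from A and B restores it. Conversely, if x ∉ S, the
-- leaves a and b of a split lie below distinct children, one of which contains no leaf of a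
-- requester of x; there A and B are balanced, so removing a but not b unbalances them.

open import Defs
open import Data.Nat using (ℕ; zero; suc; _+_; _*_; _∸_; _≤_; _<_; z≤n; s≤s)
open import Data.Nat.Properties
  using (≤-trans; ≤-<-trans; ≤-antisym; <⇒≤; <-irrefl; _≤?_; ≰⇒>; m≤m*n; m∸n+n≡m; +-comm; +-suc;
         module ≤-Reasoning)
open import Data.Fin using (Fin; toℕ; fromℕ<; _≟_)
open import Data.Fin.Properties using (toℕ<n; toℕ-fromℕ<; any?)
open import Data.Fin.Subset using (Subset; _∈_; _∉_)
open import Data.Fin.Subset.Properties using (_∈?_)
open import Data.Maybe using (just; nothing; _>>=_)
open import Data.Maybe.Properties using (just-injective)
open import Data.List using (List; []; _∷_; length; filter; allFin)
open import Data.List.Properties using (filter-notAll)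
open import Data.List.Membership.Propositional using () renaming (_∈_ to _∈ᴸ_)
open import Data.List.Membership.Propositional.Properties using (∈-filter⁺; ∈-filter⁻; ∈-allFin)
open import Data.List.Relation.Unary.All using () renaming (lookup to All-lookup)
open import Data.List.Relation.Unary.AllPairs using (_∷_)
open import Data.List.Relation.Unary.Any using (Any; here; there) renaming (map to Any-map)
open import Data.List.Relation.Unary.Unique.Propositional using (Unique)
open import Data.List.Relation.Unary.Unique.Propositional.Properties using (allFin⁺; filter⁺)
open import Data.Product using (∃-syntax; _×_; _,_; proj₁; proj₂)
open import Data.Sum using (_⊎_; inj₁; inj₂; [_,_])
open import Function using (id; _∘_)
open import Function.Bundles using (_⇔_; mk⇔)
open import Level using (0ℓ)
open import Relation.Binary.Definitions using (DecidableEquality)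
open import Relation.Binary.PropositionalEquality
  using (_≡_; _≢_; refl; sym; trans; cong; subst; module ≡-Reasoning)
open import Relation.Nullary using (¬_; Dec; yes; no; contradiction)
open import Relation.Nullary.Decidable using (¬?; map′; _×-dec_; _⊎-dec_; decidable-stable)
open import Relation.Unary using (Pred; Decidable)

module _ {n : ℕ} (t : RTree n) where

  IsLCA-swap : ∀ {w u v} → IsLCA t w u v → IsLCA t w v u
  IsLCA-swap (wu , wv , greatest) = wv , wu , λ w′ w′v w′u → greatest w′ w′u w′v

  OnPath-swap : ∀ {x u v} → OnPath t x u v → OnPath t x v u
  OnPath-swap (w , lca , wx , side) = w , IsLCA-swap lca , wx , [ inj₂ , inj₁ ] side

  Leaf⇒≢Inner : ∀ {u v} → Leaf t u → Inner t v → u ≢ v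
  Leaf⇒≢Inner leaf (c , ch) refl = leaf c ch

  module _ (S : Subset n) (π σ : Fin n → Fin n) where

    Identifies-swap : Identifies t S π σ → Identifies t S σ π
    Identifies-swap ident s s∈S = IsLCA-swap (ident s s∈S)

    UniqueRequest-swap : UniqueRequest t S π σ → UniqueRequest t S σ π
    UniqueRequest-swap uniq x s s′ s∈S s′∈S req req′ =
      uniq x s s′ s∈S s′∈S (OnPath-swap req) (OnPath-swap req′)

module Ancestry {n : ℕ} (t : RTree n) (G : IsGoodTree t) where
  open RTree t
  open IsGoodTree G

  iter-suc : ∀ k y → iter t (suc k) y ≡ (iter t k y >>= parent)
  iter-suc k y with iter t k y
  ... | nothing = refl
  ... | just _  = refl

  iter-+ : ∀ m {k y z} → iter t k y ≡ just z → iter t m z ≡ iter t (m + k) y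
  iter-+ zero    eq = sym eq
  iter-+ (suc m) {k} {y} {z} eq = begin
    iter t (suc m) z               ≡⟨ iter-suc m z ⟩
    (iter t m z >>= parent)        ≡⟨ cong (_>>= parent) (iter-+ m eq) ⟩
    (iter t (m + k) y >>= parent)  ≡⟨ sym (iter-suc (m + k) y) ⟩
    iter t (suc m + k) y           ∎
    where open ≡-Reasoning

  iter-nothing : ∀ m {k y} → iter t k y ≡ nothing → iter t (m + k) y ≡ nothing
  iter-nothing zero    eq = eq
  iter-nothing (suc m) {k} {y} eq =
    trans (iter-suc (m + k) y) (cong (_>>= parent) (iter-nothing m eq))

  depth : Fin n → ℕ
  depth y = toℕ (proj₁ (root-anc y))

  iter-past-root : ∀ y → iter t (suc (depth y)) y ≡ nothing
  iter-past-root y =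
    trans (iter-suc (depth y) y) (trans (cong (_>>= parent) (proj₂ (root-anc y))) root-noParent)

  iter-just⇒≤depth : ∀ {k y x} → iter t k y ≡ just x → k ≤ depth y
  iter-just⇒≤depth {k} {y} eq with k ≤? depth y
  ... | yes k≤d = k≤d
  ... | no  k≰d = contradiction (trans (sym eq) iter-k-nothing) λ ()
    where
      iter-k-nothing : iter t k y ≡ nothing
      iter-k-nothing = subst (λ j → iter t j y ≡ nothing) (m∸n+n≡m (≰⇒> k≰d))
                             (iter-nothing (k ∸ suc (depth y)) (iter-past-root y))

  iter-acyclic : ∀ p y → iter t (suc p) y ≢ just y
  iter-acyclic p y eq =
    <-irrefl refl (≤-trans (m≤m*n (suc (depth y)) (suc p)) (iter-just⇒≤depth (cycle (suc (depth y)))))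
    where
      cycle : ∀ j → iter t (j * suc p) y ≡ just y
      cycle zero    = refl
      cycle (suc j) = trans (sym (iter-+ (suc p) (cycle j))) eq

  AncN : Fin n → Fin n → Set
  AncN x y = ∃[ k ] iter t k y ≡ just x

  Anc⇒AncN : ∀ {x y} → Anc t x y → AncN x y
  Anc⇒AncN (k , eq) = toℕ k , eq

  AncN⇒Anc : ∀ {x y} → AncN x y → Anc t x y
  AncN⇒Anc {x} {y} (k , eq) =
    fromℕ< k<1+n , subst (λ j → iter t j y ≡ just x) (sym (toℕ-fromℕ< k<1+n)) eq
    where
      k<1+n : k < suc n
      k<1+n = ≤-<-trans (iter-just⇒≤depth eq) (toℕ<n (proj₁ (root-anc y)))

  Anc-refl : ∀ {x} → Anc t x x
  Anc-refl = AncN⇒Anc (0 , refl)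

  Anc-trans : ∀ {x y z} → Anc t x y → Anc t y z → Anc t x z
  Anc-trans xy yz with Anc⇒AncN xy | Anc⇒AncN yz
  ... | k , eq | m , eq′ = AncN⇒Anc (k + m , trans (sym (iter-+ k eq′)) eq)

  Anc-antisym : ∀ {x y} → Anc t x y → Anc t y x → x ≡ y
  Anc-antisym {x} {y} xy yx with Anc⇒AncN xy | Anc⇒AncN yx
  ... | zero  , eq | _        = sym (just-injective eq)
  ... | suc k , eq | m , eq′ = contradiction y-cycle (iter-acyclic (m + k) y)
    where
      open ≡-Reasoning
      y-cycle : iter t (suc (m + k)) y ≡ just y
      y-cycle = begin
        iter t (suc (m + k)) y  ≡⟨ cong (λ j → iter t j y) (sym (+-suc m k)) ⟩
        iter t (m + suc k) y    ≡⟨ sym (iter-+ m eq) ⟩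
        iter t m x              ≡⟨ eq′ ⟩
        just y                  ∎

  iter-≤⇒Anc : ∀ {k m z x y} → k ≤ m → iter t k z ≡ just x → iter t m z ≡ just y → Anc t y x
  iter-≤⇒Anc {k} {m} {z} {y = y} k≤m eq eq′ = AncN⇒Anc (m ∸ k , trans (iter-+ (m ∸ k) eq) eq″)
    where
      eq″ : iter t (m ∸ k + k) z ≡ just y
      eq″ = subst (λ j → iter t j z ≡ just y) (sym (m∸n+n≡m k≤m)) eq′

  Anc-total : ∀ {x y z} → Anc t x z → Anc t y z → Anc t x y ⊎ Anc t y x
  Anc-total xz yz with Anc⇒AncN xz | Anc⇒AncN yz
  ... | k , eq | m , eq′ with k ≤? m
  ...   | yes k≤m = inj₂ (iter-≤⇒Anc k≤m eq eq′)
  ...   | no  k≰m = inj₁ (iter-≤⇒Anc (<⇒≤ (≰⇒> k≰m)) eq′ eq)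

  Child⇒Anc : ∀ {c x} → Child t c x → Anc t x c
  Child⇒Anc {c} ch = AncN⇒Anc (1 , trans (iter-suc 0 c) ch)

  Anc-strict⇒Anc-parent : ∀ {a c x} → Child t c x → Anc t a c → a ≢ c → Anc t a x
  Anc-strict⇒Anc-parent {a} {c} ch ac a≢c with Anc⇒AncN ac
  ... | zero  , eq = contradiction (sym (just-injective eq)) a≢c
  ... | suc k , eq = AncN⇒Anc (k , trans (iter-+ k (trans (iter-suc 0 c) ch)) eq′)
    where
      eq′ : iter t (k + 1) c ≡ just a
      eq′ = subst (λ j → iter t j c ≡ just a) (+-comm 1 k) eq

  Child⇒¬Anc : ∀ {c x} → Child t c x → ¬ Anc t c x
  Child⇒¬Anc {c} ch cx with Anc-antisym cx (Child⇒Anc ch)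
  ... | refl = iter-acyclic 0 c (trans (iter-suc 0 c) ch)

  Child-disjoint : ∀ {c c′ x v} → Child t c x → Child t c′ x → Anc t c v → Anc t c′ v → c ≡ c′
  Child-disjoint {c} {c′} ch ch′ cv c′v with c ≟ c′
  ... | yes c≡c′ = c≡c′
  ... | no  c≢c′ = [ (λ cc′ → contradiction (Anc-strict⇒Anc-parent ch′ cc′ c≢c′) (Child⇒¬Anc ch))
                   , (λ c′c → contradiction (Anc-strict⇒Anc-parent ch c′c (c≢c′ ∘ sym)) (Child⇒¬Anc ch′))
                   ] (Anc-total cv c′v)

  Child-Anc-split : ∀ {c x v s} → Child t c x → Anc t c v → Anc t s v → Anc t c s ⊎ Anc t s x
  Child-Anc-split {c} {s = s} ch cv sv with Anc-total cv sv | s ≟ c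
  ... | inj₁ cs | _        = inj₁ cs
  ... | inj₂ _  | yes refl = inj₁ Anc-refl
  ... | inj₂ sc | no  s≢c  = inj₂ (Anc-strict⇒Anc-parent ch sc s≢c)

  Anc⇒Child-Anc : ∀ {x v} → Anc t x v → v ≢ x → ∃[ c ] Child t c x × Anc t c v
  Anc⇒Child-Anc {x} {v} xv v≢x with Anc⇒AncN xv
  ... | zero  , eq = contradiction (just-injective eq) v≢x
  ... | suc k , eq with iter t k v in eq′
  ...   | just c = c , eq , AncN⇒Anc (k , eq′)

  IsLCA-unique : ∀ {w w′ u v} → IsLCA t w u v → IsLCA t w′ u v → w ≡ w′
  IsLCA-unique (wu , wv , greatest) (w′u , w′v , greatest′) =
    Anc-antisym (greatest′ _ wu wv) (greatest _ w′u w′v)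

module _ {a b} {A : Set a} {B : Set b} (_≟ᴮ_ : DecidableEquality B) where

  length-≤-injection : ∀ {xs : List A} {ys : List B} (h : A → B) → Unique xs →
    (∀ {u v} → u ∈ᴸ xs → v ∈ᴸ xs → h u ≡ h v → u ≡ v) → (∀ {u} → u ∈ᴸ xs → h u ∈ᴸ ys) →
    length xs ≤ length ys
  length-≤-injection {[]}     h _            _   _    = z≤n
  length-≤-injection {x ∷ xs} {ys} h (x∉xs ∷ xs!) inj into =
    ≤-trans (s≤s length-xs≤) (filter-notAll ≢hx? ys (Any-map (λ eq ne → ne (sym eq)) (into (here refl))))
    where
      ≢hx? = λ v → ¬? (v ≟ᴮ h x)
      into-rest : ∀ {u} → u ∈ᴸ xs → h u ∈ᴸ filter ≢hx? ys
      into-rest p =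
        ∈-filter⁺ ≢hx? (into (there p)) λ eq → All-lookup x∉xs p (sym (inj (there p) (here refl) eq))
      length-xs≤ : length xs ≤ length (filter ≢hx? ys)
      length-xs≤ = length-≤-injection h xs! (λ p q → inj (there p) (there q)) into-rest

module Counting {n : ℕ} (t : RTree n) where

  InjectiveOn : Subset n → (Fin n → Fin n) → Set
  InjectiveOn S f = ∀ s s′ → s ∈ S → s′ ∈ S → f s ≡ f s′ → s ≡ s′

  private
    ∈-filter-allFin⁻ : ∀ {P : Pred (Fin n) 0ℓ} (P? : Decidable P) {v} → v ∈ᴸ filter P? (allFin n) → P v
    ∈-filter-allFin⁻ P? p = proj₂ (∈-filter⁻ P? {xs = allFin n} p)

  module _ {P Q : Pred (Fin n) 0ℓ} {P? : Decidable P} {Q? : Decidable Q} where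

    count-≤-injection : (h : Fin n → Fin n) → (∀ {v} → P v → Q (h v)) →
      (∀ {u v} → P u → P v → h u ≡ h v → u ≡ v) → count t P P? ≤ count t Q Q?
    count-≤-injection h PQ inj = length-≤-injection _≟_ h (filter⁺ P? (allFin⁺ n))
      (λ p q → inj (∈-filter-allFin⁻ P? p) (∈-filter-allFin⁻ P? q))
      (λ {u} p → ∈-filter⁺ Q? (∈-allFin (h u)) (PQ (∈-filter-allFin⁻ P? p)))

    count-mono : (∀ {v} → P v → Q v) → count t P P? ≤ count t Q Q?
    count-mono PQ = count-≤-injection id PQ (λ _ _ eq → eq)

    count-< : (∀ {v} → P v → Q v) → ∀ {a} → Q a → ¬ P a → count t P P? < count t Q Q?
    count-< PQ {a} Qa ¬Pa = ≤-trans (s≤s count-P≤) (filter-notAll ≢a? Qs a∈Qs)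
      where
        Qs = filter Q? (allFin n)
        ≢a? = λ v → ¬? (v ≟ a)
        a∈Qs : Any (λ v → ¬ ¬ v ≡ a) Qs
        a∈Qs = Any-map (λ eq ne → ne (sym eq)) (∈-filter⁺ Q? (∈-allFin a) Qa)
        into : ∀ {v} → v ∈ᴸ filter P? (allFin n) → v ∈ᴸ filter ≢a? Qs
        into {v} p with Pv ← ∈-filter-allFin⁻ P? p =
          ∈-filter⁺ ≢a? (∈-filter⁺ Q? (∈-allFin v) (PQ Pv)) λ { refl → ¬Pa Pv }
        count-P≤ : count t P P? ≤ length (filter ≢a? Qs)
        count-P≤ = length-≤-injection _≟_ id (filter⁺ P? (allFin⁺ n)) (λ _ _ eq → eq) into

  module _ (S : Subset n) (f : Fin n → Fin n) where

    preimage : Fin n → Fin n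
    preimage v with InImg? t S f v
    ... | yes (s , _) = s
    ... | no  _       = v

    preimage-spec : ∀ {v} → InImg t S f v → preimage v ∈ S × f (preimage v) ≡ v
    preimage-spec {v} img with InImg? t S f v
    ... | yes (_ , s∈S , eq) = s∈S , eq
    ... | no  ¬img           = contradiction img ¬img

    count-image-≤ : ∀ {P Q : Pred (Fin n) 0ℓ} {P? : Decidable P} {Q? : Decidable Q} (g : Fin n → Fin n) →
      InjectiveOn S g → (∀ {v} → P v → InImg t S f v) → (∀ {s} → s ∈ S → P (f s) → Q (g s)) →
      count t P P? ≤ count t Q Q?
    count-image-≤ {P} {Q} g g-inj P⊆img PQ = count-≤-injection (g ∘ preimage) transport inj
      where
        transport : ∀ {v} → P v → Q (g (preimage v))
        transport {v} Pv with s∈S , eq ← preimage-spec (P⊆img Pv) = PQ s∈S (subst P (sym eq) Pv)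
        inj : ∀ {u v} → P u → P v → g (preimage u) ≡ g (preimage v) → u ≡ v
        inj Pu Pv eq with u∈S , equ ← preimage-spec (P⊆img Pu) | v∈S , eqv ← preimage-spec (P⊆img Pv) =
          trans (sym equ) (trans (cong f (g-inj _ _ u∈S v∈S eq)) eqv)

  cntImg≡⇒cntImgMinus< : ∀ {S f g c a b} → cntImg t S f c ≡ cntImg t S g c →
    InImg t S f a → Anc t c a → ¬ Anc t c b → cntImgMinus t S f a c < cntImgMinus t S g b c
  cntImg≡⇒cntImgMinus< {S} {f} {g} {c} {a} {b} balanced a∈A ca ¬cb = begin-strict
    cntImgMinus t S f a c  <⟨ count-< (λ ((img , _) , cv) → img , cv) (a∈A , ca) (λ ((_ , a≢a) , _) → a≢a refl) ⟩
    cntImg t S f c         ≡⟨ balanced ⟩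
    cntImg t S g c         ≤⟨ count-mono (λ (img , cv) → (img , λ { refl → ¬cb cv }) , cv) ⟩
    cntImgMinus t S g b c  ∎
    where open ≤-Reasoning

module IdentifyingPair {n : ℕ} (t : RTree n) (G : IsGoodTree t)
  (S : Subset n) (S-inner : ∀ s → s ∈ S → ¬ Leaf t s) (π σ : Fin n → Fin n)
  (π-leaf-inj : InjectiveLeafMapOn t S π σ π) (σ-leaf-inj : InjectiveLeafMapOn t S π σ σ)
  (ident : Identifies t S π σ) (uniq : UniqueRequest t S π σ) where

  open Ancestry t G
  open Counting t

  σ-inj : InjectiveOn S σ
  σ-inj = proj₂ σ-leaf-inj

  Anc-π : ∀ {s} → s ∈ S → Anc t s (π s)
  Anc-π s∈S = proj₁ (ident _ s∈S)

  Anc-σ : ∀ {s} → s ∈ S → Anc t s (σ s)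
  Anc-σ s∈S = proj₁ (proj₂ (ident _ s∈S))

  Anc-π-σ⇒Anc : ∀ {s w} → s ∈ S → Anc t w (π s) → Anc t w (σ s) → Anc t w s
  Anc-π-σ⇒Anc s∈S = proj₂ (proj₂ (ident _ s∈S)) _

  SRequested⇒ : ∀ {s x} → s ∈ S → SRequested t S π σ s x →
    Anc t s x × (Anc t x (π s) ⊎ Anc t x (σ s))
  SRequested⇒ s∈S (w , lca , wx , side) with IsLCA-unique lca (ident _ s∈S)
  ... | refl = wx , side

  ⇒SRequested : ∀ {s x} → s ∈ S → Anc t s x → Anc t x (π s) ⊎ Anc t x (σ s) →
    SRequested t S π σ s x
  ⇒SRequested s∈S sx side = _ , ident _ s∈S , sx , side

  Requested? : ∀ x → Dec (Requested t S π σ x)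
  Requested? x = map′
    (λ (s , s∈S , sx , side) → s , s∈S , ⇒SRequested s∈S sx side)
    (λ (s , s∈S , req) → s , s∈S , SRequested⇒ s∈S req)
    (any? λ s → (s ∈? S) ×-dec (Anc? t s x ×-dec (Anc? t x (π s) ⊎-dec Anc? t x (σ s))))

  self-requested : ∀ {x} → x ∈ S → SRequested t S π σ x x
  self-requested x∈S = ⇒SRequested x∈S Anc-refl (inj₁ (Anc-π x∈S))

  requester≡ : ∀ {r x} → r ∈ S → SRequested t S π σ r x → Anc t x (π r) → Anc t x (σ r) → r ≡ x
  requester≡ r∈S req xπ xσ = Anc-antisym (proj₁ (SRequested⇒ r∈S req)) (Anc-π-σ⇒Anc r∈S xπ xσ)

  -- A common leaf π r = σ s is both r- and s-requested, so r = s, and then r is the least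
  -- common ancestor of π r with itself, i.e. a leaf.
  π≢σ : ∀ {r s} → r ∈ S → s ∈ S → π r ≢ σ s
  π≢σ {r} {s} r∈S s∈S πr≡σs = S-inner r r∈S (subst (Leaf t) (sym r≡πr) (proj₁ π-leaf-inj r r∈S))
    where
      πr-σs : Anc t (π r) (σ s)
      πr-σs = subst (Anc t (π r)) πr≡σs Anc-refl
      r≡s : r ≡ s
      r≡s = uniq (π r) r s r∈S s∈S (⇒SRequested r∈S (Anc-π r∈S) (inj₁ Anc-refl))
              (⇒SRequested s∈S (subst (Anc t s) (sym πr≡σs) (Anc-σ s∈S)) (inj₂ πr-σs))
      r≡πr : r ≡ π r
      r≡πr = Anc-antisym (Anc-π r∈S)
               (Anc-π-σ⇒Anc r∈S Anc-refl (subst (λ s → Anc t (π r) (σ s)) (sym r≡s) πr-σs))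

  module _ (x : Fin n) where

    σ-follows-π : ∀ {c s} → Child t c x → s ∈ S → ¬ SRequested t S π σ s x →
      Anc t c (π s) → Anc t c (σ s)
    σ-follows-π ch s∈S ¬req cπ =
      [ (λ cs → Anc-trans cs (Anc-σ s∈S))
      , (λ sx → contradiction (⇒SRequested s∈S sx (inj₁ (Anc-trans (Child⇒Anc ch) cπ))) ¬req)
      ] (Child-Anc-split ch cπ (Anc-π s∈S))

    cntImg-≤ : ∀ {c} → Child t c x → (∀ {s} → s ∈ S → SRequested t S π σ s x → ¬ Anc t c (π s)) →
      cntImg t S π c ≤ cntImg t S σ c
    cntImg-≤ ch away = count-image-≤ S π σ σ-inj proj₁ λ {s} s∈S (_ , cπ) →
      (s , s∈S , refl) , σ-follows-π ch s∈S (λ req → away s∈S req cπ) cπ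

    cntImgMinus-≤ : ∀ {c zπ zσ} → Child t c x →
      (∀ {s} → s ∈ S → Anc t c (π s) → π s ≢ zπ → ¬ SRequested t S π σ s x × σ s ≢ zσ) →
      cntImgMinus t S π zπ c ≤ cntImgMinus t S σ zσ c
    cntImgMinus-≤ ch H = count-image-≤ S π σ σ-inj (proj₁ ∘ proj₁) λ {s} s∈S ((_ , πs≢zπ) , cπ) →
      let ¬req , σs≢zσ = H s∈S cπ πs≢zπ in
      ((s , s∈S , refl) , σs≢zσ) , σ-follows-π ch s∈S ¬req cπ

    cntImgMinus-self-≤ : ∀ {c} → x ∈ S → Child t c x →
      cntImgMinus t S π (π x) c ≤ cntImgMinus t S σ (σ x) c
    cntImgMinus-self-≤ x∈S ch = cntImgMinus-≤ ch λ s∈S _ πs≢πx →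
      (λ req → πs≢πx (cong π (uniq x _ x s∈S x∈S req (self-requested x∈S)))) ,
      (λ σs≡σx → πs≢πx (cong π (σ-inj _ _ s∈S x∈S σs≡σx)))

    cntImgMinus-requester-π-≤ : ∀ {c r} → r ∈ S → SRequested t S π σ r x → Child t c x →
      cntImgMinus t S π (π r) c ≤ cntImgMinus t S σ (π r) c
    cntImgMinus-requester-π-≤ r∈S r-req ch = cntImgMinus-≤ ch λ s∈S _ πs≢πr →
      (λ req → πs≢πr (cong π (uniq x _ _ s∈S r∈S req r-req))) ,
      (λ σs≡πr → π≢σ r∈S s∈S (sym σs≡πr))

    cntImgMinus-requester-σ-≤ : ∀ {c r} → x ∉ S → r ∈ S → SRequested t S π σ r x → Anc t x (σ r) →
      Child t c x → cntImgMinus t S π (σ r) c ≤ cntImgMinus t S σ (σ r) c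
    cntImgMinus-requester-σ-≤ {c} {r} x∉S r∈S r-req xσ ch = cntImgMinus-≤ ch λ s∈S cπ _ →
      (λ req → ≢r s∈S cπ (uniq x _ _ s∈S r∈S req r-req)) ,
      (λ σs≡σr → ≢r s∈S cπ (σ-inj _ _ s∈S r∈S σs≡σr))
      where
        ≢r : ∀ {s} → s ∈ S → Anc t c (π s) → s ≢ r
        ≢r s∈S cπ refl = x∉S (subst (_∈ S) (requester≡ r∈S r-req (Anc-trans (Child⇒Anc ch) cπ) xσ) r∈S)

    Touches : Fin n → Fin n → Set
    Touches c s = Anc t c (π s) ⊎ Anc t c (σ s)

    Untouched : Fin n → Set
    Untouched c = ∀ {s} → s ∈ S → SRequested t S π σ s x → ¬ Touches c s

    requester-touches-one-child : ∀ {r ca cb} → x ∉ S → r ∈ S → SRequested t S π σ r x →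
      Child t ca x → Child t cb x → Touches ca r → Touches cb r → ca ≡ cb
    requester-touches-one-child {r} x∉S r∈S r-req cha chb = λ where
        (inj₁ aπ) (inj₁ bπ) → Child-disjoint cha chb aπ bπ
        (inj₂ aσ) (inj₂ bσ) → Child-disjoint cha chb aσ bσ
        (inj₁ aπ) (inj₂ bσ) → contradiction (r-splits-at-x (below cha aπ) (below chb bσ)) x∉S
        (inj₂ aσ) (inj₁ bπ) → contradiction (r-splits-at-x (below chb bπ) (below cha aσ)) x∉S
      where
        below : ∀ {c v} → Child t c x → Anc t c v → Anc t x v
        below ch = Anc-trans (Child⇒Anc ch)
        r-splits-at-x : Anc t x (π r) → Anc t x (σ r) → x ∈ S
        r-splits-at-x xπ xσ = subst (_∈ S) (requester≡ r∈S r-req xπ xσ) r∈S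

    untouched-child : ∀ {ca cb} → x ∉ S → Child t ca x → Child t cb x → ca ≢ cb →
      Untouched ca ⊎ Untouched cb
    untouched-child {ca} {cb} x∉S cha chb ca≢cb with Requested? x
    ... | no ¬req = inj₁ λ s∈S req _ → ¬req (_ , s∈S , req)
    ... | yes (r , r∈S , r-req) with Anc? t ca (π r) ⊎-dec Anc? t ca (σ r)
    ...   | yes a-touched = inj₂ λ s∈S req b-touched → ca≢cb (requester-touches-one-child x∉S r∈S r-req
                              cha chb a-touched (subst (Touches cb) (uniq x _ _ s∈S r∈S req r-req) b-touched))
    ...   | no ¬a-touched = inj₁ λ s∈S req a-touched →
                              ¬a-touched (subst (Touches ca) (uniq x _ _ s∈S r∈S req r-req) a-touched)

module Classification {n : ℕ} (t : RTree n) (G : IsGoodTree t)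
  (S : Subset n) (S-inner : ∀ s → s ∈ S → ¬ Leaf t s) (π σ : Fin n → Fin n)
  (π-leaf-inj : InjectiveLeafMapOn t S π σ π) (σ-leaf-inj : InjectiveLeafMapOn t S π σ σ)
  (ident : Identifies t S π σ) (uniq : UniqueRequest t S π σ) (x : Fin n) where

  open Ancestry t G
  open Counting t
  open IdentifyingPair t G S S-inner π σ π-leaf-inj σ-leaf-inj ident uniq
  -- All hypotheses are symmetric in π and σ, so every one-sided inequality also holds reversed.
  module Swapped = IdentifyingPair t G S S-inner σ π σ-leaf-inj π-leaf-inj
    (Identifies-swap t S π σ ident) (UniqueRequest-swap t S π σ uniq)

  untouched⇒cntImg≡ : ∀ {c} → Child t c x → Untouched x c → cntImg t S π c ≡ cntImg t S σ c
  untouched⇒cntImg≡ ch untouched = ≤-antisym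
    (cntImg-≤ x ch λ s∈S req cπ → untouched s∈S req (inj₁ cπ))
    (Swapped.cntImg-≤ x ch λ s∈S req cσ → untouched s∈S (OnPath-swap t req) (inj₂ cσ))

  ∈⇒SplitCond : x ∈ S → SplitCond t S π σ x
  ∈⇒SplitCond x∈S = π x , σ x , (x , x∈S , refl) , Anc-π x∈S , (x , x∈S , refl) , Anc-σ x∈S ,
    λ c ch → ≤-antisym (cntImgMinus-self-≤ x x∈S ch) (Swapped.cntImgMinus-self-≤ x x∈S ch) ,
             λ (cπ , cσ) → Child⇒¬Anc ch (Anc-π-σ⇒Anc x∈S cπ cσ)

  ∉⇒¬SplitCond : Inner t x → x ∉ S → ¬ SplitCond t S π σ x
  ∉⇒¬SplitCond inner x∉S (a , b , a∈A@(sa , sa∈S , refl) , xa , b∈B@(sb , sb∈S , refl) , xb , split)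
    with ca , cha , caa ← Anc⇒Child-Anc xa (Leaf⇒≢Inner t (proj₁ π-leaf-inj sa sa∈S) inner)
       | cb , chb , cbb ← Anc⇒Child-Anc xb (Leaf⇒≢Inner t (proj₁ σ-leaf-inj sb sb∈S) inner) =
    [ (λ (untouched : Untouched x ca) → <-irrefl (proj₁ (split ca cha))
         (cntImg≡⇒cntImgMinus< (untouched⇒cntImg≡ cha untouched) a∈A caa ¬cab))
    , (λ (untouched : Untouched x cb) → <-irrefl (sym (proj₁ (split cb chb)))
         (cntImg≡⇒cntImgMinus< (sym (untouched⇒cntImg≡ chb untouched)) b∈B cbb ¬cba))
    ] (untouched-child x x∉S cha chb ca≢cb)
    where
      ¬cab : ¬ Anc t ca b
      ¬cab cab = proj₂ (split ca cha) (caa , cab)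
      ¬cba : ¬ Anc t cb a
      ¬cba cba = proj₂ (split cb chb) (cba , cbb)
      ca≢cb : ca ≢ cb
      ca≢cb refl = ¬cab cbb

  case1 : x ∉ S → ¬ Requested t S π σ x → Case1 t S π σ x
  case1 x∉S ¬req = x∉S , ¬req , λ c ch → untouched⇒cntImg≡ ch λ s∈S req _ → ¬req (_ , s∈S , req)

  case2 : x ∉ S → Requested t S π σ x → Case2 t S π σ x
  case2 x∉S (r , r∈S , r-req) = x∉S , (r , r∈S , r-req) , removed-leaf (proj₂ (SRequested⇒ r∈S r-req))
    where
      r-req′ = OnPath-swap t r-req
      removed-leaf : Anc t x (π r) ⊎ Anc t x (σ r) →
        ∃[ z ] ((InImg t S π z ⊎ InImg t S σ z) × Anc t x z ×
          (∀ c → Child t c x → cntImgMinus t S π z c ≡ cntImgMinus t S σ z c))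
      removed-leaf (inj₁ xπ) = π r , inj₁ (r , r∈S , refl) , xπ , λ c ch →
        ≤-antisym (cntImgMinus-requester-π-≤ x r∈S r-req ch)
                  (Swapped.cntImgMinus-requester-σ-≤ x x∉S r∈S r-req′ xπ ch)
      removed-leaf (inj₂ xσ) = σ r , inj₂ (r , r∈S , refl) , xσ , λ c ch →
        ≤-antisym (cntImgMinus-requester-σ-≤ x x∉S r∈S r-req xσ ch)
                  (Swapped.cntImgMinus-requester-π-≤ x r∈S r-req′ ch)

  case3 : x ∈ S → Case3 t S π σ x
  case3 x∈S = x∈S , (x , x∈S , self-requested x∈S) , ∈⇒SplitCond x∈S

  exactly-one : ExactlyOne t S π σ x
  exactly-one = some-case , (λ (c₁ , c₂) → proj₁ (proj₂ c₁) (proj₁ (proj₂ c₂)))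
                          , (λ (c₁ , c₃) → proj₁ c₁ (proj₁ c₃))
                          , (λ (c₂ , c₃) → proj₁ c₂ (proj₁ c₃))
    where
      some-case : Case1 t S π σ x ⊎ Case2 t S π σ x ⊎ Case3 t S π σ x
      some-case with x ∈? S | Requested? x
      ... | yes x∈S | _       = inj₂ (inj₂ (case3 x∈S))
      ... | no  x∉S | yes req = inj₂ (inj₁ (case2 x∉S req))
      ... | no  x∉S | no ¬req = inj₁ (case1 x∉S ¬req)

  ∈⇔SplitCond : Inner t x → x ∈ S ⇔ SplitCond t S π σ x
  ∈⇔SplitCond inner =
    mk⇔ ∈⇒SplitCond λ split → decidable-stable (x ∈? S) λ x∉S → ∉⇒¬SplitCond inner x∉S split

lemma3p5 : ∀ {n} (t : RTree n) → IsGoodTree t →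
    (S : Subset n) → (∀ s → s ∈ S → ¬ Leaf t s) →
    (π σ : Fin n → Fin n) →
    InjectiveLeafMapOn t S π σ π → InjectiveLeafMapOn t S π σ σ →
    Identifies t S π σ → UniqueRequest t S π σ →
    ∀ x → Inner t x →
    ExactlyOne t S π σ x × (x ∈ S ⇔ SplitCond t S π σ x)
lemma3p5 t G S S-inner π σ π-inj σ-inj ident uniq x inner = exactly-one , ∈⇔SplitCond inner
  where open Classification t G S S-inner π σ π-inj σ-inj ident uniq x
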